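{- Let $n,k,r$ be positive integers with $r\geq 2$, $n\geq k$ and $n-r(k-1)\geq 0$. Let $\tau:\mathbb{N}\to\{0,1,\ldots,r-1\}$ be a color-frequency mapping such that $r-1\in\tau(\mathbb{N})$. Then $$\chi_M(\tau,K_n^k)\leq \min\left(\left\{|A| : \varnothing\neq A\subset\mathbb{N},\ A\text{ finite},\ \sum_{a\in A}\tau(a)\geq n-r(k-1)\right\}\cup\{+\infty\}\right).$$
   Context: $K_n^k$ is the complete $k$-uniform hypergraph with vertex set $[n]=\{1,\ldots,n\}$ and hyperedge set all $k$-subsets of $[n]$. A matching of size $m$ is a set of $m$ pairwise disjoint hyperedges. A color-frequency mapping is any map $\tau:\mathbb{N}\to\{0,1,\ldots,r-1\}$. For $A\subseteq\mathbb{N}$, an $(A,\tau)$-matching coloring of a hypergraph $\mathcal H$ is a map $c:E(\mathcal H)\to A$ such that for every $a\in A$ there is no matching of size $\tau(a)+1$ all of whose hyperedges have color $a$. The $\tau$-matching chromatic number $\chi_M(\tau,\mathcal H)$ is the least $|A|$ over finite $A\subset\mathbb{N}$ for which $\mathcal H$ admits an $(A,\tau)$-matching coloring, and $+\infty$ if no such finite $A$ exists. -}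

module Defs where

open import Data.Nat using (ℕ; suc; _≤_)
open import Data.Fin using (Fin; toℕ)
open import Data.Fin.Subset using (Subset; ∣_∣; _∩_; Empty)
open import Data.Product using (Σ; ∃; _×_; proj₁)
open import Data.List using (List; length; map)
open import Data.Nat.ListAction using (sum)
open import Data.List.Relation.Unary.Unique.Propositional using (Unique)
open import Data.List.Membership.Propositional using (_∈_)
open import Relation.Binary.PropositionalEquality using (_≡_; _≢_)
open import Relation.Nullary using (¬_)

-- Hyperedges of the complete k-uniform hypergraph K_n^k on vertex set Fin n
-- (i.e. [n]): all k-element subsets of Fin n.
Edge : ℕ → ℕ → Set
Edge n k = Σ (Subset n) (λ e → ∣ e ∣ ≡ k)

DisjointEdges : ∀ {n k} → Edge n k → Edge n k → Set
DisjointEdges e f = Empty (proj₁ e ∩ proj₁ f)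

IsMatching : ∀ {n k} (m : ℕ) → (Fin m → Edge n k) → Set
IsMatching m M = ∀ i j → i ≢ j → DisjointEdges (M i) (M j)

-- A finite subset A of ℕ is represented as a duplicate-free list; |A| = length.
FinSubsetℕ : Set
FinSubsetℕ = Σ (List ℕ) Unique

card : FinSubsetℕ → ℕ
card A = length (proj₁ A)

ColorFreq : ℕ → Set
ColorFreq r = ℕ → Fin r

IsMatchingColoring : ∀ {r} (n k : ℕ) (τ : ColorFreq r) (A : FinSubsetℕ)
                     (c : Edge n k → ℕ) → Set
IsMatchingColoring n k τ A c =
  (∀ e → c e ∈ proj₁ A) ×
  (∀ a → a ∈ proj₁ A →
     ¬ (Σ (Fin (suc (toℕ (τ a))) → Edge n k) λ M →
          IsMatching (suc (toℕ (τ a))) M × (∀ i → c (M i) ≡ a)))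

-- χ_M(τ, K_n^k) ≤ m  (for m a natural number): there is a finite A ⊂ ℕ with
-- |A| ≤ m such that K_n^k admits an (A,τ)-matching coloring.
χM≤ : ∀ {r} (τ : ColorFreq r) (n k m : ℕ) → Set
χM≤ τ n k m = Σ FinSubsetℕ λ A → card A ≤ m × ∃ λ c → IsMatchingColoring n k τ A c

τ-sum : ∀ {r} → ColorFreq r → FinSubsetℕ → ℕ
τ-sum τ A = sum (map (λ a → toℕ (τ a)) (proj₁ A))

-- Fix a with τ(a) = r − 1 and let O be A with one element removed, namely a when
-- a ∈ A; then a ∷ O has at most |A| colours, and S = Σ_{b∈O} τ(b) satisfies
-- n − S < r k. Cut the first S vertices into consecutive blocks of τ(b) vertices, one
-- per b ∈ O. An edge meeting the first S vertices takes the colour of the block of such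
-- a vertex, every other edge takes colour a. Disjoint edges of colour b meet the block
-- of b in distinct vertices, so there are at most τ(b) of them; edges of colour a lie
-- in the last n − S < r k vertices, so at most r − 1 = τ(a) of them are disjoint.
module Submission where

open import Defs
open import Data.Nat using (ℕ; _≤_; _*_; _∸_; _≥_)
open import Data.Fin using (toℕ)
open import Data.Product using (Σ; ∃; proj₁)
open import Data.List using ([])
open import Relation.Binary.PropositionalEquality using (_≡_; _≢_)

open import Data.Nat using (zero; suc; _+_; _<_; z≤n; s≤s; _<?_)
open import Data.Nat.Properties
open import Data.Nat.ListAction using (sum)
open import Data.Nat.ListAction.Properties using (sum-↭)
open import Data.Fin as Fin using (Fin; fromℕ<)
open import Data.Fin.Properties using (toℕ-injective; toℕ-fromℕ<; toℕ<n; any?; injective⇒≤)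
  renaming (suc-injective to Fin-suc-injective)
open import Data.Fin.Subset using (Subset; ∣_∣; _─_; _⊆_; inside; outside)
  renaming (_∈_ to _∈ₛ_)
open import Data.Fin.Subset.Properties using (_∈?_; x∈p∩q⁺; drop-∷-⊆; x∈p∧x∉q⇒x∈p─q)
open import Data.Vec using (_∷_; [])
open import Data.Vec.Base using (here; there)
open import Data.List using (List; _∷_; map)
open import Data.List.Relation.Unary.Any using (here; there)
import Data.List.Relation.Unary.All as All
open import Data.List.Relation.Unary.AllPairs using ([]; _∷_)
open import Data.List.Relation.Unary.All.Properties.Core using (¬Any⇒All¬)
open import Data.List.Membership.Propositional using (_∈_; _∉_)
open import Data.List.Relation.Unary.Unique.Propositional using (Unique)
open import Data.List.Relation.Binary.Permutation.Propositional using (_↭_; prep; swap; ↭-refl; ↭-sym; ↭-trans)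
open import Data.List.Relation.Binary.Permutation.Propositional.Properties using (↭-length; ∈-resp-↭; map⁺)
open import Data.Product using (_,_; proj₂; _×_; ∃₂)
open import Data.Product.Properties using (×-≡,≡→≡)
open import Data.Empty using (⊥; ⊥-elim)
open import Function using (_∘_; Injective)
open import Relation.Nullary using (¬_; yes; no; contradiction)
open import Relation.Nullary.Decidable using (_×-dec_)
open import Relation.Binary.PropositionalEquality using (refl; sym; trans; cong; subst; module ≡-Reasoning)

∣p∣≡∣q∣+∣p─q∣ : ∀ {n} {p q : Subset n} → q ⊆ p → ∣ p ∣ ≡ ∣ q ∣ + ∣ p ─ q ∣
∣p∣≡∣q∣+∣p─q∣ {p = []}          {[]}          _   = refl
∣p∣≡∣q∣+∣p─q∣ {p = inside  ∷ p} {inside  ∷ q} q⊆p = cong suc (∣p∣≡∣q∣+∣p─q∣ (drop-∷-⊆ q⊆p))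
∣p∣≡∣q∣+∣p─q∣ {p = inside  ∷ p} {outside ∷ q} q⊆p =
  trans (cong suc (∣p∣≡∣q∣+∣p─q∣ (drop-∷-⊆ q⊆p))) (sym (+-suc ∣ q ∣ ∣ p ─ q ∣))
∣p∣≡∣q∣+∣p─q∣ {p = outside ∷ p} {outside ∷ q} q⊆p = ∣p∣≡∣q∣+∣p─q∣ (drop-∷-⊆ q⊆p)
∣p∣≡∣q∣+∣p─q∣ {p = outside ∷ p} {inside  ∷ q} q⊆p = contradiction (q⊆p here) λ ()

suffix : (n q : ℕ) → Subset n
suffix zero    q       = []
suffix (suc n) zero    = inside ∷ suffix n zero
suffix (suc n) (suc q) = outside ∷ suffix n q

∣suffix∣≡n∸q : ∀ n q → ∣ suffix n q ∣ ≡ n ∸ q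
∣suffix∣≡n∸q zero    zero    = refl
∣suffix∣≡n∸q zero    (suc q) = refl
∣suffix∣≡n∸q (suc n) zero    = cong suc (∣suffix∣≡n∸q n zero)
∣suffix∣≡n∸q (suc n) (suc q) = ∣suffix∣≡n∸q n q

∈-suffix : ∀ {n q} (v : Fin n) → q ≤ toℕ v → v ∈ₛ suffix n q
∈-suffix {suc n} {zero}  Fin.zero    _         = here
∈-suffix {suc n} {zero}  (Fin.suc v) _         = there (∈-suffix v z≤n)
∈-suffix {suc n} {suc q} (Fin.suc v) (s≤s q≤v) = there (∈-suffix v q≤v)

module _ {n k : ℕ} where

  IsMatching-tail : ∀ {m} {M : Fin (suc m) → Edge n k} →
                    IsMatching (suc m) M → IsMatching m (M ∘ Fin.suc)
  IsMatching-tail matching i j i≢j = matching (Fin.suc i) (Fin.suc j) (i≢j ∘ Fin-suc-injective)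

  matching-disjoint : ∀ {m} {M : Fin m → Edge n k} → IsMatching m M →
                      ∀ {i j v} → i ≢ j → v ∈ₛ proj₁ (M i) → v ∈ₛ proj₁ (M j) → ⊥
  matching-disjoint matching i≢j v∈Mi v∈Mj = matching _ _ i≢j (_ , x∈p∩q⁺ (v∈Mi , v∈Mj))

  representatives-injective : ∀ {m} {M : Fin m → Edge n k} → IsMatching m M →
    {rep : Fin m → Fin n} → (∀ i → rep i ∈ₛ proj₁ (M i)) → Injective _≡_ _≡_ rep
  representatives-injective {M = M} matching rep∈M {i} {j} rep-i≡rep-j with i Fin.≟ j
  ... | yes i≡j = i≡j
  ... | no  i≢j = ⊥-elim (matching-disjoint {M = M} matching i≢j (rep∈M i)
                                             (subst (_∈ₛ _) (sym rep-i≡rep-j) (rep∈M j)))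

  matching⊆⇒m*k≤∣p∣ : ∀ {m} {M : Fin m → Edge n k} {p : Subset n} → IsMatching m M →
                      (∀ i → proj₁ (M i) ⊆ p) → m * k ≤ ∣ p ∣
  matching⊆⇒m*k≤∣p∣ {zero}         _        _   = z≤n
  matching⊆⇒m*k≤∣p∣ {suc m} {M} {p} matching M⊆p = begin
    k + m * k            ≤⟨ +-monoʳ-≤ k (matching⊆⇒m*k≤∣p∣ {M = M ∘ Fin.suc}
                                                            (IsMatching-tail {M = M} matching) tail⊆p─M₀) ⟩
    k + ∣ p ─ M₀ ∣       ≡⟨ cong (_+ ∣ p ─ M₀ ∣) (sym (proj₂ (M Fin.zero))) ⟩
    ∣ M₀ ∣ + ∣ p ─ M₀ ∣  ≡⟨ ∣p∣≡∣q∣+∣p─q∣ (M⊆p Fin.zero) ⟨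
    ∣ p ∣                ∎
    where
    open ≤-Reasoning
    M₀ : Subset n
    M₀ = proj₁ (M Fin.zero)
    tail⊆p─M₀ : ∀ i → proj₁ (M (Fin.suc i)) ⊆ p ─ M₀
    tail⊆p─M₀ i v∈Mi = x∈p∧x∉q⇒x∈p─q (M⊆p (Fin.suc i) v∈Mi)
                         (λ v∈M₀ → matching-disjoint {M = M} matching (λ ()) v∈M₀ v∈Mi)

∸-<-cancel : ∀ {x a b} → a ≤ x → x < a + b → x ∸ a < b
∸-<-cancel {a = a} a≤x x<a+b = +-cancelˡ-< a _ _ (subst (_< a + _) (sym (m+[n∸m]≡n a≤x)) x<a+b)

module Blocks (w : ℕ → ℕ) where

  total : List ℕ → ℕ
  total L = sum (map w L)

  -- [0, total L) is cut into consecutive blocks of lengths w b for b ∈ L, and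
  -- locate L x = (b , i) says that x is the i-th point of the block of b.
  -- Outside [0, total L) the value is junk.
  locate : List ℕ → ℕ → ℕ × ℕ
  locate []      x = 0 , x
  locate (b ∷ L) x with x <? w b
  ... | yes _ = b , x
  ... | no  _ = locate L (x ∸ w b)

  owner : List ℕ → ℕ → ℕ
  owner L x = proj₁ (locate L x)

  offset : List ℕ → ℕ → ℕ
  offset L x = proj₂ (locate L x)

  owner∈ : ∀ L {x} → x < total L → owner L x ∈ L
  owner∈ (b ∷ L) {x} x<total with x <? w b
  ... | yes _   = here refl
  ... | no  x≮w = there (owner∈ L (∸-<-cancel (≮⇒≥ x≮w) x<total))

  offset<w-owner : ∀ L {x} → x < total L → offset L x < w (owner L x)
  offset<w-owner (b ∷ L) {x} x<total with x <? w b
  ... | yes x<w = x<w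
  ... | no  x≮w = offset<w-owner L (∸-<-cancel (≮⇒≥ x≮w) x<total)

  locate-injective : ∀ {L} → Unique L → ∀ {x y} → x < total L → y < total L →
                     locate L x ≡ locate L y → x ≡ y
  locate-injective {b ∷ L} (b∉L ∷ unique) {x} {y} x<total y<total eq
    with x <? w b | y <? w b
  ... | yes _   | yes _   = cong proj₂ eq
  ... | yes _   | no  y≮w = ⊥-elim (All.lookup b∉L (owner∈ L (∸-<-cancel (≮⇒≥ y≮w) y<total)) (cong proj₁ eq))
  ... | no  x≮w | yes _   = ⊥-elim (All.lookup b∉L (owner∈ L (∸-<-cancel (≮⇒≥ x≮w) x<total)) (sym (cong proj₁ eq)))
  ... | no  x≮w | no  y≮w = begin
    x                 ≡⟨ m+[n∸m]≡n (≮⇒≥ x≮w) ⟨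
    w b + (x ∸ w b)   ≡⟨ cong (w b +_) (locate-injective unique (∸-<-cancel (≮⇒≥ x≮w) x<total)
                                                                (∸-<-cancel (≮⇒≥ y≮w) y<total) eq) ⟩
    w b + (y ∸ w b)   ≡⟨ m+[n∸m]≡n (≮⇒≥ y≮w) ⟩
    y                 ∎
    where open ≡-Reasoning

module Colouring (n k : ℕ) (w : ℕ → ℕ) (a : ℕ) {O : List ℕ} (unique : Unique O) (a∉O : a ∉ O) where
  open Blocks w

  S : ℕ
  S = total O

  colour : Edge n k → ℕ
  colour e with any? (λ v → v ∈? proj₁ e ×-dec toℕ v <? S)
  ... | yes (v , _) = owner O (toℕ v)
  ... | no  _       = a

  colour∈ : ∀ e → colour e ∈ a ∷ O
  colour∈ e with any? (λ v → v ∈? proj₁ e ×-dec toℕ v <? S)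
  ... | yes (v , _ , v<S) = there (owner∈ O v<S)
  ... | no  _             = here refl

  colour≡a⇒⊆suffix : ∀ e → colour e ≡ a → proj₁ e ⊆ suffix n S
  colour≡a⇒⊆suffix e colour≡a {v} v∈e with any? (λ v → v ∈? proj₁ e ×-dec toℕ v <? S)
  ... | yes (u , _ , u<S) = ⊥-elim (a∉O (subst (_∈ O) colour≡a (owner∈ O u<S)))
  ... | no  none with toℕ v <? S
  ...   | yes v<S = ⊥-elim (none (v , v∈e , v<S))
  ...   | no  v≮S = ∈-suffix v (≮⇒≥ v≮S)

  record MeetsBlock (e : Edge n k) (b : ℕ) : Set where
    field
      vertex   : Fin n
      vertex∈e : vertex ∈ₛ proj₁ e
      vertex<S : toℕ vertex < S
      owner≡b  : owner O (toℕ vertex) ≡ b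

  colour≡b⇒MeetsBlock : ∀ e {b} → b ∈ O → colour e ≡ b → MeetsBlock e b
  colour≡b⇒MeetsBlock e b∈O colour≡b with any? (λ v → v ∈? proj₁ e ×-dec toℕ v <? S)
  ... | yes (v , v∈e , v<S) = record { vertex = v ; vertex∈e = v∈e ; vertex<S = v<S ; owner≡b = colour≡b }
  ... | no  _               = ⊥-elim (a∉O (subst (_∈ O) (sym colour≡b) b∈O))

  MonochromaticMatching : ℕ → ℕ → Set
  MonochromaticMatching m c = Σ (Fin m → Edge n k) λ M → IsMatching m M × (∀ i → colour (M i) ≡ c)

  no-matching-a : n ∸ S < suc (w a) * k → ¬ MonochromaticMatching (suc (w a)) a
  no-matching-a n∸S<[1+wa]k (M , matching , coloured) = <⇒≱ n∸S<[1+wa]k (begin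
    suc (w a) * k   ≤⟨ matching⊆⇒m*k≤∣p∣ {M = M} matching (λ i → colour≡a⇒⊆suffix (M i) (coloured i)) ⟩
    ∣ suffix n S ∣  ≡⟨ ∣suffix∣≡n∸q n S ⟩
    n ∸ S           ∎)
    where open ≤-Reasoning

  no-matching-b : ∀ {b} → b ∈ O → ¬ MonochromaticMatching (suc (w b)) b
  no-matching-b {b} b∈O (M , matching , coloured) = 1+n≰n (injective⇒≤ slot-injective)
    where
    open MeetsBlock
    meets : ∀ i → MeetsBlock (M i) b
    meets i = colour≡b⇒MeetsBlock (M i) b∈O (coloured i)

    rep : Fin (suc (w b)) → ℕ
    rep i = toℕ (vertex (meets i))

    slot : Fin (suc (w b)) → Fin (w b)
    slot i = fromℕ< (subst (λ c → offset O (rep i) < w c) (owner≡b (meets i))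
                           (offset<w-owner O (vertex<S (meets i))))

    slot-injective : Injective _≡_ _≡_ slot
    slot-injective {i} {j} slot-i≡slot-j =
      representatives-injective {M = M} matching (vertex∈e ∘ meets)
        (toℕ-injective (locate-injective unique (vertex<S (meets i)) (vertex<S (meets j))
          (×-≡,≡→≡ (trans (owner≡b (meets i)) (sym (owner≡b (meets j))) , same-offset))))
      where
      open ≡-Reasoning
      same-offset : offset O (rep i) ≡ offset O (rep j)
      same-offset = begin
        offset O (rep i)  ≡⟨ toℕ-fromℕ< _ ⟨
        toℕ (slot i)      ≡⟨ cong toℕ slot-i≡slot-j ⟩
        toℕ (slot j)      ≡⟨ toℕ-fromℕ< _ ⟩
        offset O (rep j)  ∎

↭-split-avoiding : ∀ a {A : List ℕ} → Unique A → A ≢ [] →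
                   ∃₂ λ x O → A ↭ x ∷ O × Unique O × a ∉ O
↭-split-avoiding a {[]}    _ []≢[] = ⊥-elim ([]≢[] refl)
↭-split-avoiding a {x ∷ xs} (x∉xs ∷ unique) _ with x ≟ a
... | yes refl = x , xs , ↭-refl , unique , λ x∈xs → All.lookup x∉xs x∈xs refl
↭-split-avoiding a {x ∷ []}     _              _ | no x≢a = x , [] , ↭-refl , [] , λ ()
↭-split-avoiding a {x ∷ y ∷ ys} (x∉y∷ys ∷ unique) _ | no x≢a
  with z , O , y∷ys↭z∷O , uniqueO , a∉O ← ↭-split-avoiding a unique (λ ()) =
  z , x ∷ O , ↭-trans (prep x y∷ys↭z∷O) (swap x z ↭-refl) ,
  All.tabulate (λ u∈O → All.lookup x∉y∷ys (∈-resp-↭ (↭-sym y∷ys↭z∷O) (there u∈O))) ∷ uniqueO ,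
  λ { (here a≡x) → x≢a (sym a≡x) ; (there a∈O) → a∉O a∈O }

n∸S<[1+r][1+k] : ∀ n S r k → n ∸ suc r * k ≤ r + S → n ∸ S < suc r * suc k
n∸S<[1+r][1+k] n S r k n∸X≤r+S = m<n+o⇒m∸n<o n S (begin-strict
  n                     ≤⟨ m≤n+m∸n n X ⟩
  X + (n ∸ X)           ≤⟨ +-monoʳ-≤ X n∸X≤r+S ⟩
  X + (r + S)           <⟨ +-monoʳ-< X (+-monoˡ-< S (n<1+n r)) ⟩
  X + (suc r + S)       ≡⟨ +-comm X (suc r + S) ⟩
  (suc r + S) + X       ≡⟨ cong (_+ X) (+-comm (suc r) S) ⟩
  (S + suc r) + X       ≡⟨ +-assoc S (suc r) X ⟩
  S + (suc r + X)       ≡⟨ cong (S +_) (*-suc (suc r) k) ⟨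
  S + suc r * suc k     ∎)
  where
  open ≤-Reasoning
  X : ℕ
  X = suc r * k

proposition2p3 : (n k r : ℕ) → 1 ≤ n → 1 ≤ k → 2 ≤ r → k ≤ n → r * (k ∸ 1) ≤ n →
    (τ : ColorFreq r) → (∃ λ a → toℕ (τ a) ≡ r ∸ 1) →
    (A : FinSubsetℕ) → proj₁ A ≢ [] → τ-sum τ A ≥ n ∸ r * (k ∸ 1) →
    χM≤ τ n k (card A)
proposition2p3 n (suc k) (suc r) _ _ _ _ _ τ (a , τa≡r) (A , uniqueA) A≢[] τ-sum≥
  with x , O , A↭x∷O , uniqueO , a∉O ← ↭-split-avoiding a uniqueA A≢[] =
  (a ∷ O , ¬Any⇒All¬ O a∉O ∷ uniqueO) , ≤-reflexive (sym (↭-length A↭x∷O)) ,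
  colour , colour∈ , no-monochromatic-matching
  where
  open Colouring n (suc k) (toℕ ∘ τ) a uniqueO a∉O

  τ-sum≤r+S : τ-sum τ (A , uniqueA) ≤ r + S
  τ-sum≤r+S = begin
    τ-sum τ (A , uniqueA)  ≡⟨ sum-↭ (map⁺ (toℕ ∘ τ) A↭x∷O) ⟩
    toℕ (τ x) + S          ≤⟨ +-monoˡ-≤ S (≤-pred (toℕ<n (τ x))) ⟩
    r + S                  ∎
    where open ≤-Reasoning

  no-monochromatic-matching : ∀ c → c ∈ a ∷ O → ¬ MonochromaticMatching (suc (toℕ (τ c))) c
  no-monochromatic-matching c (here refl) =
    no-matching-a (subst (λ t → n ∸ S < suc t * suc k) (sym τa≡r)
                         (n∸S<[1+r][1+k] n S r k (≤-trans τ-sum≥ τ-sum≤r+S)))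
  no-monochromatic-matching c (there c∈O) = no-matching-b c∈O
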